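{- If $\Gamma\vdash_\ell M:A$ is derivable in $\Lambda_\cap^\ell$, then $M$ is weakly $\beta$-normalising.
   Context: $\lambda$-terms: $M::=x\mid MM\mid\lambda x.M$ modulo $\alpha$-conversion; $M[x:=N]$ capture-avoiding substitution; $\beta$-reduction is the contextual closure of $(\lambda x.M)N\to M[x:=N]$; weakly normalising means some reduction sequence reaches a $\beta$-normal form. Types: $A::=\varphi\mid A\to A\mid A\cap A$. A typing context is a finite set of pairs $x:A$, where a variable may occur with several types; $\Gamma,x:A$ denotes $\Gamma\cup\{x:A\}$; $x\notin\Gamma$ means no $x:B$ lies in $\Gamma$. Rules of $\Lambda_\cap^\ell$ ($n\ge0$): (Ax) $\Gamma,x:A\vdash_\ell x:A$; $(\mathsf{Beta})^\ell$ from $\Gamma\vdash_\ell M[x:=N]N_1\dots N_n:A$ infer $\Gamma\vdash_\ell(\lambda x.M)NN_1\dots N_n:A$; $(\mathsf{L}\to)$ from $\Gamma\vdash_\ell N:A_1$ and $\Gamma,y:A_2\vdash_\ell yN_1\dots N_n:B$, with $y\notin FV(N_1)\cup\dots\cup FV(N_n)$, $y\notin\Gamma$, infer $\Gamma,x:A_1\to A_2\vdash_\ell xNN_1\dots N_n:B$; $(\mathsf{R}\to)$ from $\Gamma,x:A\vdash_\ell M:B$, $x\notin\Gamma$, infer $\Gamma\vdash_\ell\lambda x.M:A\to B$; $(\mathsf{L}\cap)$ from $\Gamma,x:A_1,x:A_2\vdash_\ell xN_1\dots N_n:B$ infer $\Gamma,x:A_1\cap A_2\vdash_\ell xN_1\dots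 N_n:B$; $(\mathsf{R}\cap)$ from $\Gamma\vdash_\ell M:A$ and $\Gamma\vdash_\ell M:B$ infer $\Gamma\vdash_\ell M:A\cap B$. -}

module Defs where

open import Data.Nat using (ℕ; zero; suc)
open import Data.List using (List; []; _∷_; map; foldl)
open import Data.List.Membership.Propositional using (_∈_; _∉_)
open import Data.List.Relation.Unary.All using (All)
open import Data.Product using (_×_; _,_; ∃; ∃-syntax)
open import Relation.Nullary using (¬_)
open import Function.Bundles using (_⇔_)
open import Relation.Binary.Construct.Closure.ReflexiveTransitive using (Star)

-- λ-terms modulo α-conversion: de Bruijn indices (free variables are
-- the indices that escape all binders).

data Tm : Set where
  var : ℕ → Tm
  app : Tm → Tm → Tm
  lam : Tm → Tm

apps : Tm → List Tm → Tm
apps M Ns = foldl app M Ns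

ext : (ℕ → ℕ) → ℕ → ℕ
ext ρ zero    = zero
ext ρ (suc n) = suc (ρ n)

rename : (ℕ → ℕ) → Tm → Tm
rename ρ (var x)   = var (ρ x)
rename ρ (app M N) = app (rename ρ M) (rename ρ N)
rename ρ (lam M)   = lam (rename (ext ρ) M)

exts : (ℕ → Tm) → ℕ → Tm
exts σ zero    = var zero
exts σ (suc n) = rename suc (σ n)

subst : (ℕ → Tm) → Tm → Tm
subst σ (var x)   = σ x
subst σ (app M N) = app (subst σ M) (subst σ N)
subst σ (lam M)   = lam (subst (exts σ) M)

sub0 : Tm → ℕ → Tm
sub0 N zero    = N
sub0 N (suc n) = var n

_[_] : Tm → Tm → Tm
M [ N ] = subst (sub0 N) M

data _∈FV_ : ℕ → Tm → Set where
  fv-var  : ∀ {x} → x ∈FV var x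
  fv-appˡ : ∀ {x M N} → x ∈FV M → x ∈FV app M N
  fv-appʳ : ∀ {x M N} → x ∈FV N → x ∈FV app M N
  fv-lam  : ∀ {x M} → suc x ∈FV M → x ∈FV lam M

infix 4 _⟶β_ _⟶β*_
data _⟶β_ : Tm → Tm → Set where
  β    : ∀ {M N} → app (lam M) N ⟶β M [ N ]
  appˡ : ∀ {M M' N} → M ⟶β M' → app M N ⟶β app M' N
  appʳ : ∀ {M N N'} → N ⟶β N' → app M N ⟶β app M N'
  lamξ : ∀ {M M'} → M ⟶β M' → lam M ⟶β lam M'

_⟶β*_ : Tm → Tm → Set
_⟶β*_ = Star _⟶β_

data HasRedex : Tm → Set where
  here : ∀ {M N} → HasRedex (app (lam M) N)
  inˡ  : ∀ {M N} → HasRedex M → HasRedex (app M N)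
  inʳ  : ∀ {M N} → HasRedex N → HasRedex (app M N)
  inλ  : ∀ {M} → HasRedex M → HasRedex (lam M)

NF : Tm → Set
NF M = ¬ HasRedex M

WN : Tm → Set
WN M = ∃[ N ] (M ⟶β* N × NF N)

infixr 7 _⇒_
infixr 8 _∩_
data Ty : Set where
  atom : ℕ → Ty
  _⇒_  : Ty → Ty → Ty
  _∩_  : Ty → Ty → Ty

-- Typing contexts: finite sets of pairs x : A, represented by lists
-- considered up to having the same elements.

Ctx : Set
Ctx = List (ℕ × Ty)

_≈ᶜ_ : Ctx → Ctx → Set
Δ ≈ᶜ Γ = ∀ p → (p ∈ Δ) ⇔ (p ∈ Γ)

_∉dom_ : ℕ → Ctx → Set
x ∉dom Γ = ∀ B → (x , B) ∉ Γ

shiftᶜ : Ctx → Ctx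
shiftᶜ = map (λ { (x , A) → (suc x , A) })

infix 3 _⊢ℓ_∶_
data _⊢ℓ_∶_ : Ctx → Tm → Ty → Set where
  Ax   : ∀ {Γ x A} → (x , A) ∈ Γ → Γ ⊢ℓ var x ∶ A
  Beta : ∀ {Γ M N Ns A} →
         Γ ⊢ℓ apps (M [ N ]) Ns ∶ A →
         Γ ⊢ℓ apps (app (lam M) N) Ns ∶ A
  L⇒   : ∀ {Γ Δ x y N Ns A₁ A₂ B} →
         Γ ⊢ℓ N ∶ A₁ →
         (y , A₂) ∷ Γ ⊢ℓ apps (var y) Ns ∶ B →
         All (λ Nᵢ → ¬ (y ∈FV Nᵢ)) Ns →
         y ∉dom Γ →
         Δ ≈ᶜ ((x , A₁ ⇒ A₂) ∷ Γ) →
         Δ ⊢ℓ apps (var x) (N ∷ Ns) ∶ B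
  R⇒   : ∀ {Γ M A B} →
         (zero , A) ∷ shiftᶜ Γ ⊢ℓ M ∶ B →
         Γ ⊢ℓ lam M ∶ A ⇒ B
  L∩   : ∀ {Γ Δ x Ns A₁ A₂ B} →
         (x , A₁) ∷ (x , A₂) ∷ Γ ⊢ℓ apps (var x) Ns ∶ B →
         Δ ≈ᶜ ((x , A₁ ∩ A₂) ∷ Γ) →
         Δ ⊢ℓ apps (var x) Ns ∶ B
  R∩   : ∀ {Γ M A B} →
         Γ ⊢ℓ M ∶ A → Γ ⊢ℓ M ∶ B → Γ ⊢ℓ M ∶ A ∩ B

-- Every rule of Λ∩ℓ preserves weak normalisation from premises to conclusion, so
-- induction on the derivation suffices. Ax, L∩ and R∩ are immediate, Beta prepends
-- a head β-step and R⇒ reduces under the binder. For L⇒, the term y N₁ … Nₙ can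
-- never reduce at its head, so any reduction of it to normal form is replayed
-- verbatim on x N N₁ … Nₙ, after which N is reduced to normal form inside the head.
module Submission where

open import Defs
open import Data.Nat using (ℕ)
open import Data.List using ([]; _∷_)
open import Data.Product using (_×_; _,_; ∃-syntax)
open import Relation.Binary.Construct.Closure.ReflexiveTransitive
  using (ε; _◅_; _◅◅_; gmap)

appˡ* : ∀ {M M' N} → M ⟶β* M' → app M N ⟶β* app M' N
appˡ* = gmap _ appˡ

appʳ* : ∀ {M N N'} → N ⟶β* N' → app M N ⟶β* app M N'
appʳ* = gmap _ appʳ

lam* : ∀ {M M'} → M ⟶β* M' → lam M ⟶β* lam M'
lam* = gmap lam lamξ

apps-⟶β : ∀ Ns {M M'} → M ⟶β M' → apps M Ns ⟶β apps M' Ns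
apps-⟶β []       r = r
apps-⟶β (_ ∷ Ns) r = apps-⟶β Ns (appˡ r)

NF-var : ∀ {x} → NF (var x)
NF-var ()

NF-lam : ∀ {M} → NF M → NF (lam M)
NF-lam nf (inλ h) = nf h

data HeadReplaced (y : ℕ) (H : Tm) : Tm → Tm → Set where
  head : HeadReplaced y H (var y) H
  app  : ∀ {t s u} → HeadReplaced y H t s → HeadReplaced y H (app t u) (app s u)

HeadReplaced-apps : ∀ {y H} Ns {t s} →
                    HeadReplaced y H t s → HeadReplaced y H (apps t Ns) (apps s Ns)
HeadReplaced-apps []       p = p
HeadReplaced-apps (_ ∷ Ns) p = HeadReplaced-apps Ns (app p)

-- A variable-headed spine has no head redex, so its steps are all inside the
-- arguments, which are shared with s; no condition on H is needed.
HeadReplaced-⟶β : ∀ {y H t t' s} → HeadReplaced y H t s → t ⟶β t' →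
                  ∃[ s' ] (s ⟶β s' × HeadReplaced y H t' s')
HeadReplaced-⟶β head ()
HeadReplaced-⟶β (app ()) β
HeadReplaced-⟶β (app p) (appˡ r) with HeadReplaced-⟶β p r
... | s' , r' , p' = app s' _ , appˡ r' , app p'
HeadReplaced-⟶β (app {s = s} p) (appʳ {N' = u'} r) = app s u' , appʳ r , app p

HeadReplaced-⟶β* : ∀ {y H t t' s} → HeadReplaced y H t s → t ⟶β* t' →
                   ∃[ s' ] (s ⟶β* s' × HeadReplaced y H t' s')
HeadReplaced-⟶β* p ε = _ , ε , p
HeadReplaced-⟶β* p (r ◅ rs) with HeadReplaced-⟶β p r
... | s₁ , r₁ , p₁ with HeadReplaced-⟶β* p₁ rs
... | s₂ , rs₂ , p₂ = s₂ , r₁ ◅ rs₂ , p₂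

HeadReplaced-head-⟶β* : ∀ {y H H' t s} → HeadReplaced y H t s → H ⟶β* H' →
                        ∃[ s' ] (s ⟶β* s' × HeadReplaced y H' t s')
HeadReplaced-head-⟶β* head rs = _ , rs , head
HeadReplaced-head-⟶β* (app p) rs with HeadReplaced-head-⟶β* p rs
... | s' , rs' , p' = app s' _ , appˡ* rs' , app p'

HeadReplaced-NF : ∀ {y x N t s} → HeadReplaced y (app (var x) N) t s →
                  NF t → NF N → NF s
HeadReplaced-NF head    nft nfN (inʳ h) = nfN h
HeadReplaced-NF (app p) nft nfN (inˡ h) = HeadReplaced-NF p (λ h' → nft (inˡ h')) nfN h
HeadReplaced-NF (app p) nft nfN (inʳ h) = nft (inʳ h)

WN-apps-β : ∀ {M N} Ns → WN (apps (M [ N ]) Ns) → WN (apps (app (lam M) N) Ns)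
WN-apps-β Ns (P , rs , nf) = P , apps-⟶β Ns β ◅ rs , nf

WN-lam : ∀ {M} → WN M → WN (lam M)
WN-lam (P , rs , nf) = lam P , lam* rs , NF-lam nf

WN-apps-head : ∀ {x y N} Ns → WN N → WN (apps (var y) Ns) → WN (apps (var x) (N ∷ Ns))
WN-apps-head {x} {y} {N} Ns (N' , rN , nfN) (P , rP , nfP)
  with HeadReplaced-⟶β* (HeadReplaced-apps Ns (head {y} {app (var x) N})) rP
... | s₁ , r₁ , p₁ with HeadReplaced-head-⟶β* p₁ (appʳ* rN)
... | s₂ , r₂ , p₂ = s₂ , r₁ ◅◅ r₂ , HeadReplaced-NF p₂ nfP nfN

⊢ℓ⇒WN : ∀ {Γ M A} → Γ ⊢ℓ M ∶ A → WN M
⊢ℓ⇒WN (Ax _)                     = _ , ε , NF-var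
⊢ℓ⇒WN (Beta {Ns = Ns} d)         = WN-apps-β Ns (⊢ℓ⇒WN d)
⊢ℓ⇒WN (L⇒ {Ns = Ns} dN dy _ _ _) = WN-apps-head Ns (⊢ℓ⇒WN dN) (⊢ℓ⇒WN dy)
⊢ℓ⇒WN (R⇒ d)                     = WN-lam (⊢ℓ⇒WN d)
⊢ℓ⇒WN (L∩ d _)                   = ⊢ℓ⇒WN d
⊢ℓ⇒WN (R∩ d _)                   = ⊢ℓ⇒WN d

theorem5 : ∀ (Γ : Ctx) (M : Tm) (A : Ty) → Γ ⊢ℓ M ∶ A → WN M
theorem5 Γ M A = ⊢ℓ⇒WN
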